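{- Let $n\in\mathbb{N}$, fix $\mathbf{y}=(y_1,\ldots,y_n)\in\mathbb{N}^n$ and $\sigma=\sigma_1\cdots\sigma_n\in\mathfrak{S}_n$. For every $i\in[n]$, \[|\mathrm{Pref}_{\mathsf{PS}_n}(\sigma_i)|=1+\sum_{k\in L(\mathbf{y},\sigma_i)}y_k,\] where $L(\mathbf{y},\sigma_i)=\emptyset$ if $i=1$ or $\sigma_{i-1}>\sigma_i$, and otherwise $L(\mathbf{y},\sigma_i)=\{\sigma_t,\ldots,\sigma_{i-1}\}$ where $\sigma_t\sigma_{t+1}\cdots\sigma_i$ is the longest contiguous subword of $\sigma$ ending at position $i$ with $\sigma_k<\sigma_i$ for all $t\le k<i$.
   Context: Parking sequence rule: $n$ cars $1,\ldots,n$ of lengths $y_1,\ldots,y_n$ park on $m=\sum_i y_i$ spots $1,\ldots,m$ of a one-way street, entering in order $1,\ldots,n$; car $i$ with preference $x_i\in[m]$ finds the first empty spot $j\ge x_i$ and parks in spots $j,\ldots,j+y_i-1$ if these are all empty, otherwise it fails to park (collision). The permutation $\sigma$ describes the parking order: $\sigma_j=i$ means car $i$ is the $j$th car from the left on the street, so car $\sigma_j$ occupies spots $1+\sum_{k<j}y_{\sigma_k},\ldots,\sum_{k\le j}y_{\sigma_k}$. $\mathrm{Pref}_{\mathsf{PS}_n}(\sigma_i)$ denotes the set of possible preferences for car $\sigma_i$ such that, under the parking sequence rule, it is the $i$th car to park on the street (i.e. it parks in its position prescribed by $\sigma$, given that the cars arriving before it are parked in their positions prescribed by $\sigma$). -}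

module Defs where

open import Data.Nat using (ℕ; zero; suc; _+_; _≤ᵇ_; _<ᵇ_; _≡ᵇ_)
open import Data.Bool using (Bool; true; false; if_then_else_; _∧_; not)
open import Data.Fin using (Fin; toℕ)
open import Data.Fin.Permutation using (Permutation′; _⟨$⟩ʳ_)
open import Data.List using (List; []; _∷_; map; filter; upTo; allFin; length)
open import Data.Nat.ListAction using (sum)
open import Data.Bool.ListAction using (any; all)
open import Data.Maybe using (Maybe; just; nothing)
open import Relation.Nullary.Decidable using (Dec)
open import Relation.Binary.PropositionalEquality using (_≡_)
open import Data.Bool.Properties using () renaming (T? to T?)
open import Data.Bool using (T)

-- Cars are labelled by Fin n (car k ↔ car k+1 of the paper); positions on the
-- street (left to right) are also labelled by Fin n.  σ ⟨$⟩ʳ j is the car σ_{j}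
-- at position j.  Spots are numbered 1,…,m with m = y_1+⋯+y_n.

totalLength : (n : ℕ) → (Fin n → ℕ) → ℕ
totalLength n y = sum (map y (allFin n))

start : (n : ℕ) → (Fin n → ℕ) → Permutation′ n → Fin n → ℕ
start n y σ j =
  suc (sum (map (λ k → y (σ ⟨$⟩ʳ k))
                (filter (λ k → T? (toℕ k <ᵇ toℕ j)) (allFin n))))

-- is spot p occupied at the moment car c arrives, i.e. when exactly the cars
-- with label < c are parked, each in the position prescribed by σ?
occupiedBefore : (n : ℕ) → (Fin n → ℕ) → Permutation′ n → Fin n → ℕ → Bool
occupiedBefore n y σ c p =
  any (λ k → (toℕ (σ ⟨$⟩ʳ k) <ᵇ toℕ c)
             ∧ (start n y σ k ≤ᵇ p)
             ∧ (p <ᵇ start n y σ k + y (σ ⟨$⟩ʳ k)))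
      (allFin n)

firstEmptyFrom : (ℕ → Bool) → (fuel : ℕ) → (j : ℕ) → Maybe ℕ
firstEmptyFrom occ zero j = nothing
firstEmptyFrom occ (suc f) j = if occ j then firstEmptyFrom occ f (suc j) else just j

firstEmpty : (ℕ → Bool) → (m x : ℕ) → Maybe ℕ
firstEmpty occ m x = firstEmptyFrom occ (suc m Data.Nat.∸ x) x

blockFree : (ℕ → Bool) → (m j len : ℕ) → Bool
blockFree occ m j len =
  all (λ d → not (occ (j + d)) ∧ (j + d ≤ᵇ m)) (upTo len)

parkPS : (ℕ → Bool) → (m x len : ℕ) → Maybe ℕ
parkPS occ m x len with firstEmpty occ m x
... | nothing = nothing
... | just j  = if blockFree occ m j len then just j else nothing

parksAt : Maybe ℕ → ℕ → Bool
parksAt nothing  s = false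
parksAt (just j) s = j ≡ᵇ s

-- Pref_{PS_n}(σ_i): preferences x ∈ [m] such that car σ_i, arriving when the cars
-- before it are parked as prescribed by σ, parks in its prescribed position i.
Pref : (n : ℕ) → (Fin n → ℕ) → Permutation′ n → Fin n → List ℕ
Pref n y σ i =
  filter (λ x → T? (parksAt
            (parkPS (occupiedBefore n y σ (σ ⟨$⟩ʳ i)) (totalLength n y) x (y (σ ⟨$⟩ʳ i)))
            (start n y σ i)))
         (map suc (upTo (totalLength n y)))

-- positions k belonging to the longest contiguous run σ_t ⋯ σ_{i-1} ending just
-- before position i with σ_k < σ_i for all t ≤ k < i  (empty if i = 1 or σ_{i-1} > σ_i)
inRunL : (n : ℕ) → Permutation′ n → Fin n → Fin n → Bool
inRunL n σ i k =
  (toℕ k <ᵇ toℕ i)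
  ∧ all (λ k' → not ((toℕ k ≤ᵇ toℕ k') ∧ (toℕ k' <ᵇ toℕ i))
               Data.Bool.∨ (toℕ (σ ⟨$⟩ʳ k') <ᵇ toℕ (σ ⟨$⟩ʳ i)))
        (allFin n)

sumL : (n : ℕ) → (Fin n → ℕ) → Permutation′ n → Fin n → ℕ
sumL n y σ i = sum (map (λ k → y (σ ⟨$⟩ʳ k)) (filter (λ k → T? (inRunL n σ i k)) (allFin n)))

-- Number the positions on the street from 0 and let ends j be the total length of the cars at
-- positions < j, so the car at position j occupies spots ends j + 1, …, ends (j + 1).  Let the run
-- L(y, σ_i) be the positions first, …, i − 1.  When σ_i arrives, every spot in (ends first, ends i]
-- is taken, since its owner lies in the run and so has a smaller label; spot ends first, if it exists,
-- is empty, since its owner σ_{first − 1} has a larger label; and σ_i's own spots are empty.  Hence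
-- σ_i parks in its own spots exactly for the preferences in (ends first, ends i + 1], and there are
-- 1 + ends i − ends first = 1 + Σ_{k ∈ L} y_k of them.

module Submission where

open import Defs
open import Data.Nat using (ℕ; _+_; _≤_)
open import Data.Fin using (Fin)
open import Data.Fin.Permutation using (Permutation′)
open import Data.List using (length)
open import Relation.Binary.PropositionalEquality using (_≡_)

open import Data.Bool using (Bool; true; false; T; not; _∧_; _∨_; if_then_else_)
open import Data.Bool.Properties using (T-∧; T?)
open import Data.Bool.ListAction using (any; all)
open import Data.Empty using (⊥-elim)
open import Data.Fin using (toℕ; fromℕ<)
import Data.Fin as Fin
open import Data.Fin.Permutation using (_⟨$⟩ʳ_)
open import Data.Fin.Properties using (toℕ<n; toℕ-injective; toℕ-fromℕ<)
open import Data.List using (List; []; _∷_; _++_; map; filter; upTo; applyUpTo; tabulate; allFin)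
open import Data.List.Properties using (map-upTo; filter-++; filter-none; filter-all; length-applyUpTo; ++-identityʳ)
open import Data.List.Membership.Propositional using (_∈_; lose)
open import Data.List.Membership.Propositional.Properties using (∈-applyUpTo⁻; ∈-upTo⁻; ∈-allFin)
import Data.List.Relation.Unary.All as All
open import Data.List.Relation.Unary.All.Properties using (all⁺; all⁻)
open import Data.List.Relation.Unary.Any using (satisfied)
open import Data.List.Relation.Unary.Any.Properties using (any⁺; any⁻)
open import Data.Maybe using (just)
open import Data.Maybe.Properties using (just-injective)
open import Data.Nat using (zero; suc; _<_; _∸_; _≤ᵇ_; _<ᵇ_; _≤?_; _<?_; z≤n; s≤s; s≤s⁻¹; z<s)
open import Data.Nat.ListAction using (sum)
open import Data.Nat.Properties
open import Algebra.Properties.CommutativeMonoid.Sum +-0-commutativeMonoid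
  using (sum-cong-≗; ∑-distrib-+; sum-permute; sum-replicate-zero) renaming (sum to ∑)
open import Data.Product using (_×_; _,_; ∃; proj₁; proj₂)
open import Data.Sum using (_⊎_; inj₁; inj₂; [_,_]′)
open import Function using (_∘_; _⇔_; mk⇔; Equivalence)
open import Level using (Level)
open import Relation.Binary.Definitions using (tri<; tri≈; tri>)
open import Relation.Nullary using (¬_; contradiction; yes; no)
open import Relation.Unary using (Pred; Decidable)
open import Relation.Binary.PropositionalEquality using (refl; sym; trans; cong; cong₂; subst; module ≡-Reasoning)

private variable
  a ℓ : Level
  A : Set a

T-not⁺ : ∀ {b} → ¬ T b → T (not b)
T-not⁺ {false} _  = _
T-not⁺ {true}  ¬t = ¬t _

T-not-∧-∨ : ∀ {a b c} → T (not (a ∧ b) ∨ c) ⇔ (T a → T b → T c)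
T-not-∧-∨ {true}  {true}  = mk⇔ (λ c _ _ → c) (λ f → f _ _)
T-not-∧-∨ {true}  {false} = mk⇔ (λ _ _ ()) _
T-not-∧-∨ {false}         = mk⇔ (λ _ ()) _

T-all-allFin : ∀ {n} (p : Fin n → Bool) → T (all p (allFin n)) ⇔ (∀ k → T (p k))
T-all-allFin {n} p = mk⇔ (λ t k → All.lookup (all⁺ p _ t) (∈-allFin k))
                         (λ f → all⁻ p {xs = allFin n} (All.tabulate λ {k} _ → f k))

T-any-allFin : ∀ {n} (p : Fin n → Bool) → T (any p (allFin n)) ⇔ ∃ (T ∘ p)
T-any-allFin {n} p = mk⇔ (satisfied ∘ any⁻ p (allFin n)) (λ (k , pk) → any⁺ p (lose (∈-allFin k) pk))

applyUpTo-+ : ∀ (f : ℕ → A) m n → applyUpTo f (m + n) ≡ applyUpTo f m ++ applyUpTo (f ∘ (m +_)) n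
applyUpTo-+ f zero    n = refl
applyUpTo-+ f (suc m) n = cong (f 0 ∷_) (applyUpTo-+ (f ∘ suc) m n)

length-filter-interval : {P : Pred ℕ ℓ} (P? : Decidable P) {lo hi m : ℕ} → lo ≤ hi → hi ≤ m →
  (∀ {x} → 0 < x → P x → lo < x × x ≤ hi) → (∀ {x} → lo < x → x ≤ hi → P x) →
  length (filter P? (map suc (upTo m))) ≡ hi ∸ lo
length-filter-interval {P = P} P? {lo} {hi} {m} lo≤hi hi≤m sound complete = begin
  length (filter P? (map suc (upTo m)))
    ≡⟨ cong (length ∘ filter P?) (trans (map-upTo suc m) split) ⟩
  length (filter P? (below ++ inside ++ above))
    ≡⟨ cong length (trans (filter-++ P? below _) (cong (filter P? below ++_) (filter-++ P? inside above))) ⟩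
  length (filter P? below ++ filter P? inside ++ filter P? above)
    ≡⟨ cong₂ (λ u v → length (u ++ v ++ filter P? above))
         (filter-none P? (All.tabulate none-below)) (filter-all P? (All.tabulate all-inside)) ⟩
  length (inside ++ filter P? above)
    ≡⟨ cong (λ u → length (inside ++ u)) (filter-none P? (All.tabulate none-above)) ⟩
  length (inside ++ [])
    ≡⟨ cong length (++-identityʳ inside) ⟩
  length inside
    ≡⟨ length-applyUpTo _ d ⟩
  d ∎
  where
  open ≡-Reasoning
  d : ℕ
  d = hi ∸ lo
  below inside above : List ℕ
  below  = applyUpTo suc lo
  inside = applyUpTo (suc ∘ (lo +_)) d
  above  = applyUpTo (suc ∘ (lo +_) ∘ (d +_)) (m ∸ hi)

  lo+d≡hi : lo + d ≡ hi
  lo+d≡hi = m+[n∸m]≡n lo≤hi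

  split : applyUpTo suc m ≡ below ++ inside ++ above
  split = begin
    applyUpTo suc m                                   ≡⟨ cong (applyUpTo suc) m≡ ⟩
    applyUpTo suc (lo + (d + (m ∸ hi)))               ≡⟨ applyUpTo-+ suc lo _ ⟩
    below ++ applyUpTo (suc ∘ (lo +_)) (d + (m ∸ hi)) ≡⟨ cong (below ++_) (applyUpTo-+ (suc ∘ (lo +_)) d _) ⟩
    below ++ inside ++ above ∎
    where
    m≡ : m ≡ lo + (d + (m ∸ hi))
    m≡ = sym (begin
      lo + (d + (m ∸ hi)) ≡⟨ +-assoc lo d _ ⟨
      lo + d + (m ∸ hi)   ≡⟨ cong (_+ (m ∸ hi)) lo+d≡hi ⟩
      hi + (m ∸ hi)       ≡⟨ m+[n∸m]≡n hi≤m ⟩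
      m                   ∎)

  none-below : ∀ {x} → x ∈ below → ¬ P x
  none-below x∈ Px with j , j<lo , refl ← ∈-applyUpTo⁻ suc x∈ = <⇒≱ (proj₁ (sound z<s Px)) j<lo

  all-inside : ∀ {x} → x ∈ inside → P x
  all-inside x∈ with j , j<d , refl ← ∈-applyUpTo⁻ _ x∈ =
    complete (s≤s (m≤m+n lo j)) (subst (lo + j <_) lo+d≡hi (+-monoʳ-< lo j<d))

  none-above : ∀ {x} → x ∈ above → ¬ P x
  none-above x∈ Px with j , _ , refl ← ∈-applyUpTo⁻ _ x∈ = <⇒≱ hi<x (proj₂ (sound z<s Px))
    where
    hi<x : hi < suc (lo + (d + j))
    hi<x = s≤s (subst (_≤ lo + (d + j)) lo+d≡hi (≤-trans (m≤m+n (lo + d) j) (≤-reflexive (+-assoc lo d j))))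

crossing : (F : ℕ → ℕ) {t p : ℕ} → ∀ i → t ≤ i → F t < p → p ≤ F i →
  ∃ λ j → t ≤ j × j < i × F j < p × p ≤ F (suc j)
crossing F zero    z≤n   Ft<p p≤Fi = contradiction Ft<p (≤⇒≯ p≤Fi)
crossing F {p = p} (suc i) t≤1+i Ft<p p≤Fi with m≤n⇒m<n∨m≡n t≤1+i
... | inj₂ refl = contradiction Ft<p (≤⇒≯ p≤Fi)
... | inj₁ t<1+i with p ≤? F i
...   | yes p≤Fi-1 = let j , t≤j , j<i , rest = crossing F i (s≤s⁻¹ t<1+i) Ft<p p≤Fi-1
                     in j , t≤j , m<n⇒m<1+n j<i , rest
...   | no  p≰Fi-1 = i , s≤s⁻¹ t<1+i , n<1+n i , ≰⇒> p≰Fi-1 , p≤Fi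

record Run {n q} (Q : Pred (Fin n) q) (j : ℕ) : Set q where
  field
    first   : ℕ
    first≤  : first ≤ j
    inside  : ∀ k → first ≤ toℕ k → toℕ k < j → Q k
    blocked : first ≡ 0 ⊎ ∃ λ k → suc (toℕ k) ≡ first × ¬ Q k

longestRun : ∀ {n q} {Q : Pred (Fin n) q} → Decidable Q → ∀ j → j ≤ n → Run Q j
longestRun Q? zero _ = record { first = 0 ; first≤ = z≤n ; inside = λ _ _ () ; blocked = inj₁ refl }
longestRun {Q = Q} Q? (suc j) j<n with Q? (fromℕ< j<n)
... | no ¬Qj = record
  { first   = suc j
  ; first≤  = ≤-refl
  ; inside  = λ k j<k k<j → contradiction k<j (≤⇒≯ j<k)
  ; blocked = inj₂ (fromℕ< j<n , cong suc (toℕ-fromℕ< j<n) , ¬Qj)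
  }
... | yes Qj = record { first = first ; first≤ = m≤n⇒m≤1+n first≤ ; inside = inside′ ; blocked = blocked }
  where
  open Run (longestRun Q? j (<⇒≤ j<n))
  inside′ : ∀ k → first ≤ toℕ k → toℕ k < suc j → Q k
  inside′ k first≤k k<1+j with m≤n⇒m<n∨m≡n (s≤s⁻¹ k<1+j)
  ... | inj₁ k<j  = inside k first≤k k<j
  ... | inj₂ k≡j = subst Q (toℕ-injective (trans (toℕ-fromℕ< j<n) (sym k≡j))) Qj

sum-map-tabulate : ∀ {n} (f : Fin n → A) (w : A → ℕ) → sum (map w (tabulate f)) ≡ ∑ (w ∘ f)
sum-map-tabulate {n = zero}  f w = refl
sum-map-tabulate {n = suc n} f w = cong (w (f Fin.zero) +_) (sum-map-tabulate (f ∘ Fin.suc) w)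

sum-filter-tabulate : ∀ {n} (f : Fin n → A) (p : A → Bool) (w : A → ℕ) →
  sum (map w (filter (λ x → T? (p x)) (tabulate f))) ≡ ∑ (λ k → if p (f k) then w (f k) else 0)
sum-filter-tabulate {n = zero}  f p w = refl
sum-filter-tabulate {n = suc n} f p w with p (f Fin.zero)
... | true  = cong (w (f Fin.zero) +_) (sum-filter-tabulate (f ∘ Fin.suc) p w)
... | false = sum-filter-tabulate (f ∘ Fin.suc) p w

if-⊎ : ∀ {a b c} x → (T a ⇔ (T b ⊎ T c)) → (T b → ¬ T c) →
  (if a then x else 0) ≡ (if b then x else 0) + (if c then x else 0)
if-⊎ {true}  {true}  {true}  x _   b⇒¬c = ⊥-elim (b⇒¬c _ _)
if-⊎ {true}  {true}  {false} x _   _    = sym (+-identityʳ x)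
if-⊎ {true}  {false} {true}  x _   _    = refl
if-⊎ {true}  {false} {false} x a⇔ _    = ⊥-elim ([ (λ ()) , (λ ()) ]′ (Equivalence.to a⇔ _))
if-⊎ {false} {true}          x a⇔ _    = ⊥-elim (Equivalence.from a⇔ (inj₁ _))
if-⊎ {false} {false} {true}  x a⇔ _    = ⊥-elim (Equivalence.from a⇔ (inj₂ _))
if-⊎ {false} {false} {false} x _   _    = refl

∑-if-⊎ : ∀ {n} (w : Fin n → ℕ) {p q r : Fin n → Bool} →
  (∀ k → T (p k) ⇔ (T (q k) ⊎ T (r k))) → (∀ k → T (q k) → ¬ T (r k)) →
  ∑ (λ k → if p k then w k else 0) ≡ ∑ (λ k → if q k then w k else 0) + ∑ (λ k → if r k then w k else 0)
∑-if-⊎ w {p} {q} {r} p⇔ disjoint = trans (sum-cong-≗ (λ k → if-⊎ (w k) (p⇔ k) (disjoint k)))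
                                          (∑-distrib-+ (λ k → if q k then w k else 0) (λ k → if r k then w k else 0))

∑-prefix-suc : ∀ {n} (w : Fin n → ℕ) (k : Fin n) →
  ∑ (λ j → if toℕ j <ᵇ suc (toℕ k) then w j else 0) ≡ ∑ (λ j → if toℕ j <ᵇ toℕ k then w j else 0) + w k
∑-prefix-suc {suc n} w Fin.zero    = +-comm (w Fin.zero) _
∑-prefix-suc {suc n} w (Fin.suc k) =
  trans (cong (w Fin.zero +_) (∑-prefix-suc (w ∘ Fin.suc) k)) (sym (+-assoc (w Fin.zero) _ _))

module _ (occ : ℕ → Bool) where

  firstEmptyFrom-≥ : ∀ f {x j} → firstEmptyFrom occ f x ≡ just j → x ≤ j
  firstEmptyFrom-≥ (suc f) {x} eq with occ x
  ... | true  = <⇒≤ (firstEmptyFrom-≥ f eq)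
  firstEmptyFrom-≥ (suc f) refl | false = ≤-refl

  firstEmptyFrom-free : ∀ f {x j} → firstEmptyFrom occ f x ≡ just j → ¬ T (occ j)
  firstEmptyFrom-free (suc f) {x} eq with occ x in occx
  ... | true  = firstEmptyFrom-free f eq
  firstEmptyFrom-free (suc f) refl | false = subst T occx

  firstEmptyFrom-≤ : ∀ f {x e} → x ≤ e → e < x + f → ¬ T (occ e) →
    ∃ λ j → firstEmptyFrom occ f x ≡ just j × j ≤ e
  firstEmptyFrom-≤ zero    {x} x≤e e<x+0 _ = contradiction (subst (_ <_) (+-identityʳ x) e<x+0) (≤⇒≯ x≤e)
  firstEmptyFrom-≤ (suc f) {x} {e} x≤e e<x+f free with occ x in occx
  ... | false = x , refl , x≤e
  ... | true with m≤n⇒m<n∨m≡n x≤e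
  ...   | inj₁ x<e = firstEmptyFrom-≤ f x<e (subst (e <_) (+-suc x f) e<x+f) free
  ...   | inj₂ refl = contradiction (subst T (sym occx) _) free

  module _ {m x : ℕ} where

    firstEmpty-≥ : ∀ {j} → firstEmpty occ m x ≡ just j → x ≤ j
    firstEmpty-≥ = firstEmptyFrom-≥ (suc m ∸ x)

    firstEmpty-≤ : ∀ {e} → x ≤ e → e ≤ m → ¬ T (occ e) → ∃ λ j → firstEmpty occ m x ≡ just j × j ≤ e
    firstEmpty-≤ {e} x≤e e≤m = firstEmptyFrom-≤ (suc m ∸ x) x≤e
      (subst (e <_) (sym (m+[n∸m]≡n (≤-trans x≤e (m≤n⇒m≤1+n e≤m)))) (s≤s e≤m))

    firstEmpty-exact : ∀ {s} → x ≤ s → s ≤ m → (∀ {p} → x ≤ p → p < s → T (occ p)) → ¬ T (occ s) →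
      firstEmpty occ m x ≡ just s
    firstEmpty-exact x≤s s≤m full free with firstEmpty-≤ x≤s s≤m free
    ... | j , eq , j≤s with m≤n⇒m<n∨m≡n j≤s
    ...   | inj₁ j<s = contradiction (full (firstEmpty-≥ eq) j<s) (firstEmptyFrom-free (suc m ∸ x) eq)
    ...   | inj₂ refl = eq

  blockFree⁺ : ∀ {m j len} → (∀ {d} → d < len → ¬ T (occ (j + d)) × j + d ≤ m) → T (blockFree occ m j len)
  blockFree⁺ free = all⁻ _ (All.tabulate λ d∈ → let (¬occ , ≤m) = free (∈-upTo⁻ d∈)
    in Equivalence.from T-∧ (T-not⁺ ¬occ , ≤⇒≤ᵇ ≤m))

  parksAt-parkPS⁺ : ∀ {m x len s} → firstEmpty occ m x ≡ just s → T (blockFree occ m s len) →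
    T (parksAt (parkPS occ m x len) s)
  parksAt-parkPS⁺ {m} {len = len} {s} eq free rewrite eq with blockFree occ m s len
  ... | true = ≡⇒≡ᵇ s s refl

  parksAt-parkPS⁻ : ∀ {m x len s} → T (parksAt (parkPS occ m x len) s) → firstEmpty occ m x ≡ just s
  parksAt-parkPS⁻ {m} {x} {len} {s} parks with firstEmpty occ m x
  ... | just j with blockFree occ m j len
  ...   | true = cong just (≡ᵇ⇒≡ j s parks)

module Street (n : ℕ) (y : Fin n → ℕ) (σ : Permutation′ n) where

  len : Fin n → ℕ
  len k = y (σ ⟨$⟩ʳ k)

  -- start n y σ k unfolds to suc (ends (toℕ k))
  ends : ℕ → ℕ
  ends j = sum (map len (filter (λ k → T? (toℕ k <ᵇ j)) (allFin n)))

  InBlock : ℕ → ℕ → Set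
  InBlock j p = ends j < p × p ≤ ends (suc j)

  ends-∑ : ∀ j → ends j ≡ ∑ (λ k → if toℕ k <ᵇ j then len k else 0)
  ends-∑ j = sum-filter-tabulate (λ k → k) (λ k → toℕ k <ᵇ j) len

  ends-zero : ends 0 ≡ 0
  ends-zero = trans (ends-∑ 0) (sum-replicate-zero n)

  ends-suc : ∀ k → ends (suc (toℕ k)) ≡ ends (toℕ k) + len k
  ends-suc k = trans (ends-∑ (suc (toℕ k)))
                     (trans (∑-prefix-suc len k) (cong (_+ len k) (sym (ends-∑ (toℕ k)))))

  ends-split : ∀ (r : Fin n → Bool) {a b} → a ≤ b → (∀ k → T (r k) ⇔ (a ≤ toℕ k × toℕ k < b)) →
    ends b ≡ ends a + sum (map len (filter (λ k → T? (r k)) (allFin n)))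
  ends-split r {a} {b} a≤b r⇔ = begin
    ends b                                                    ≡⟨ ends-∑ b ⟩
    ∑ (λ k → if toℕ k <ᵇ b then len k else 0)                 ≡⟨ ∑-if-⊎ len below⇔ disjoint ⟩
    ∑ (λ k → if toℕ k <ᵇ a then len k else 0) + ∑ (λ k → if r k then len k else 0)
      ≡⟨ cong₂ _+_ (sym (ends-∑ a)) (sym (sum-filter-tabulate (λ k → k) r len)) ⟩
    ends a + sum (map len (filter (λ k → T? (r k)) (allFin n))) ∎
    where
    open ≡-Reasoning
    below⇔ : ∀ k → T (toℕ k <ᵇ b) ⇔ (T (toℕ k <ᵇ a) ⊎ T (r k))
    below⇔ k = mk⇔ to from
      where
      to : T (toℕ k <ᵇ b) → T (toℕ k <ᵇ a) ⊎ T (r k)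
      to k<b with toℕ k <? a
      ... | yes k<a = inj₁ (<⇒<ᵇ k<a)
      ... | no  k≮a = inj₂ (Equivalence.from (r⇔ k) (≮⇒≥ k≮a , <ᵇ⇒< _ _ k<b))
      from : T (toℕ k <ᵇ a) ⊎ T (r k) → T (toℕ k <ᵇ b)
      from (inj₁ k<a) = <⇒<ᵇ (<-≤-trans (<ᵇ⇒< _ _ k<a) a≤b)
      from (inj₂ rk)  = <⇒<ᵇ (proj₂ (Equivalence.to (r⇔ k) rk))
    disjoint : ∀ k → T (toℕ k <ᵇ a) → ¬ T (r k)
    disjoint k k<a rk = <⇒≱ (<ᵇ⇒< _ _ k<a) (proj₁ (Equivalence.to (r⇔ k) rk))

  ends-mono : ∀ {a b} → a ≤ b → ends a ≤ ends b
  ends-mono {a} {b} a≤b = subst (ends a ≤_) (sym (ends-split between a≤b between⇔)) (m≤m+n _ _)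
    where
    between : Fin n → Bool
    between k = (a ≤ᵇ toℕ k) ∧ (toℕ k <ᵇ b)
    between⇔ : ∀ k → T (between k) ⇔ (a ≤ toℕ k × toℕ k < b)
    between⇔ k = mk⇔ (λ t → let (a≤k , k<b) = Equivalence.to T-∧ t in ≤ᵇ⇒≤ _ _ a≤k , <ᵇ⇒< _ _ k<b)
                     (λ (a≤k , k<b) → Equivalence.from T-∧ (≤⇒≤ᵇ a≤k , <⇒<ᵇ k<b))

  ends-total : ends n ≡ totalLength n y
  ends-total = begin
    ends n                                    ≡⟨ ends-∑ n ⟩
    ∑ (λ k → if toℕ k <ᵇ n then len k else 0) ≡⟨ sum-cong-≗ every-position ⟩
    ∑ len                                     ≡⟨ sum-permute y σ ⟨
    ∑ y                                       ≡⟨ sum-map-tabulate (λ k → k) y ⟨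
    totalLength n y                           ∎
    where
    open ≡-Reasoning
    every-position : ∀ k → (if toℕ k <ᵇ n then len k else 0) ≡ len k
    every-position k with toℕ k <ᵇ n | <⇒<ᵇ (toℕ<n k)
    ... | true | _ = refl

  ends≤total : ∀ {j} → j ≤ n → ends j ≤ totalLength n y
  ends≤total {j} j≤n = subst (ends j ≤_) ends-total (ends-mono j≤n)

  inBlock-unique : ∀ {j j′ p} → InBlock j p → InBlock j′ p → j ≡ j′
  inBlock-unique {j} {j′} (ej<p , p≤ej+1) (ej′<p , p≤ej′+1) with <-cmp j j′
  ... | tri< j<j′ _ _ = contradiction (≤-trans p≤ej+1 (ends-mono j<j′)) (<⇒≱ ej′<p)
  ... | tri≈ _ j≡j′ _ = j≡j′
  ... | tri> _ _ j′<j = contradiction (≤-trans p≤ej′+1 (ends-mono j′<j)) (<⇒≱ ej<p)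

  occupied⇔ : ∀ c p → T (occupiedBefore n y σ c p) ⇔ ∃ λ k → toℕ (σ ⟨$⟩ʳ k) < toℕ c × InBlock (toℕ k) p
  occupied⇔ c p = mk⇔ to from
    where
    to : T (occupiedBefore n y σ c p) → ∃ λ k → toℕ (σ ⟨$⟩ʳ k) < toℕ c × InBlock (toℕ k) p
    to occ with k , t ← Equivalence.to (T-any-allFin _) occ =
      let (earlier , t′) = Equivalence.to T-∧ t
          (after , before) = Equivalence.to T-∧ t′
      in k , <ᵇ⇒< _ _ earlier , ≤ᵇ⇒≤ _ _ after
           , subst (p ≤_) (sym (ends-suc k)) (s≤s⁻¹ (<ᵇ⇒< _ _ before))
    from : (∃ λ k → toℕ (σ ⟨$⟩ʳ k) < toℕ c × InBlock (toℕ k) p) → T (occupiedBefore n y σ c p)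
    from (k , earlier , after , before) = Equivalence.from (T-any-allFin _) (k ,
      Equivalence.from T-∧ (<⇒<ᵇ earlier , Equivalence.from T-∧
        (≤⇒≤ᵇ after , <⇒<ᵇ (s≤s (subst (p ≤_) (ends-suc k) before)))))

  module Arrival (hy : ∀ k → 1 ≤ y k) (i : Fin n) where

    Earlier : Fin n → Set
    Earlier k = toℕ (σ ⟨$⟩ʳ k) < toℕ (σ ⟨$⟩ʳ i)

    open Run (longestRun (λ k → toℕ (σ ⟨$⟩ʳ k) <? toℕ (σ ⟨$⟩ʳ i)) (toℕ i) (<⇒≤ (toℕ<n i))) public

    m s : ℕ
    m = totalLength n y
    s = start n y σ i

    occupied : ℕ → Bool
    occupied = occupiedBefore n y σ (σ ⟨$⟩ʳ i)

    ends<ends-suc : ∀ k → ends (toℕ k) < ends (suc (toℕ k))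
    ends<ends-suc k = subst (ends (toℕ k) <_) (sym (ends-suc k)) (m<m+n _ (hy (σ ⟨$⟩ʳ k)))

    s≤m : s ≤ m
    s≤m = ≤-trans (ends<ends-suc i) (ends≤total (toℕ<n i))

    first≤s : ends first ≤ s
    first≤s = m≤n⇒m≤1+n (ends-mono first≤)

    inRunL⇔ : ∀ k → T (inRunL n σ i k) ⇔ (first ≤ toℕ k × toℕ k < toℕ i)
    inRunL⇔ k = mk⇔ to from
      where
      to : T (inRunL n σ i k) → first ≤ toℕ k × toℕ k < toℕ i
      to t with k<i , all-earlier ← Equivalence.to T-∧ t = first≤k , <ᵇ⇒< _ _ k<i
        where
        earlier-from-k : ∀ k′ → toℕ k ≤ toℕ k′ → toℕ k′ < toℕ i → Earlier k′
        earlier-from-k k′ k≤k′ k′<i = <ᵇ⇒< _ _ (Equivalence.to T-not-∧-∨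
          (Equivalence.to (T-all-allFin _) all-earlier k′) (≤⇒≤ᵇ k≤k′) (<⇒<ᵇ k′<i))
        first≤k : first ≤ toℕ k
        first≤k with blocked
        ... | inj₁ first≡0 = subst (_≤ toℕ k) (sym first≡0) z≤n
        ... | inj₂ (k₀ , 1+k₀≡first , ¬earlier) with toℕ k ≤? toℕ k₀
        ...   | yes k≤k₀ = contradiction (earlier-from-k k₀ k≤k₀ (subst (_≤ toℕ i) (sym 1+k₀≡first) first≤)) ¬earlier
        ...   | no  k≰k₀ = subst (_≤ toℕ k) 1+k₀≡first (≰⇒> k≰k₀)
      from : first ≤ toℕ k × toℕ k < toℕ i → T (inRunL n σ i k)
      from (first≤k , k<i) = Equivalence.from T-∧ (<⇒<ᵇ k<i , Equivalence.from (T-all-allFin _) λ k′ →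
        Equivalence.from T-not-∧-∨ λ k≤k′ k′<i →
          <⇒<ᵇ (inside k′ (≤-trans first≤k (≤ᵇ⇒≤ _ _ k≤k′)) (<ᵇ⇒< _ _ k′<i)))

    ends≡ends-first+sumL : ends (toℕ i) ≡ ends first + sumL n y σ i
    ends≡ends-first+sumL = ends-split (inRunL n σ i) first≤ inRunL⇔

    owner-earlier : ∀ {k p} → InBlock (toℕ k) p → T (occupied p) → Earlier k
    owner-earlier block occ with k′ , earlier , block′ ← Equivalence.to (occupied⇔ _ _) occ =
      subst Earlier (toℕ-injective (inBlock-unique block′ block)) earlier

    run-occupied : ∀ {p} → ends first < p → p ≤ ends (toℕ i) → T (occupied p)
    run-occupied first<p p≤i with j , first≤j , j<i , block ← crossing ends (toℕ i) first≤ first<p p≤i =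
      Equivalence.from (occupied⇔ _ _) (k , inside k first≤k k<i , subst (λ j → InBlock j _) (sym toℕk≡j) block)
      where
      k : Fin n
      k = fromℕ< (<-trans j<i (toℕ<n i))
      toℕk≡j : toℕ k ≡ j
      toℕk≡j = toℕ-fromℕ< (<-trans j<i (toℕ<n i))
      first≤k : first ≤ toℕ k
      first≤k = subst (first ≤_) (sym toℕk≡j) first≤j
      k<i : toℕ k < toℕ i
      k<i = subst (_< toℕ i) (sym toℕk≡j) j<i

    own-free : ∀ {p} → InBlock (toℕ i) p → ¬ T (occupied p)
    own-free block occ = <-irrefl refl (owner-earlier block occ)

    gap-free : 0 < ends first → ¬ T (occupied (ends first))
    gap-free 0<first occ with blocked
    ... | inj₁ first≡0 = <-irrefl (sym (trans (cong ends first≡0) ends-zero)) 0<first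
    ... | inj₂ (k₀ , 1+k₀≡first , ¬earlier) = ¬earlier (owner-earlier block occ)
      where
      block : InBlock (toℕ k₀) (ends first)
      block = subst (λ j → ends (toℕ k₀) < ends j × ends j ≤ ends (suc (toℕ k₀))) 1+k₀≡first
                (ends<ends-suc k₀ , ≤-refl)

    Parks : ℕ → Set
    Parks x = T (parksAt (parkPS occupied m x (len i)) s)

    parks-sound : ∀ {x} → 0 < x → Parks x → ends first < x × x ≤ s
    parks-sound {x} 0<x parks = first<x , firstEmpty-≥ occupied parks-at-s
      where
      parks-at-s : firstEmpty occupied m x ≡ just s
      parks-at-s = parksAt-parkPS⁻ occupied {m} {x} {len i} parks
      first<x : ends first < x
      first<x with x ≤? ends first
      ... | no  x≰first = ≰⇒> x≰first
      ... | yes x≤first with j , found-j , j≤first ← firstEmpty-≤ occupied x≤first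
                              (≤-trans first≤s s≤m) (gap-free (<-≤-trans 0<x x≤first))
        = contradiction (subst (_≤ ends first) (just-injective (trans (sym found-j) parks-at-s)) j≤first)
                        (<⇒≱ (s≤s (ends-mono first≤)))

    parks-complete : ∀ {x} → ends first < x → x ≤ s → Parks x
    parks-complete {x} first<x x≤s = parksAt-parkPS⁺ occupied {m} {x} {len i}
      (firstEmpty-exact occupied x≤s s≤m
         (λ x≤p p<s → run-occupied (<-≤-trans first<x x≤p) (s≤s⁻¹ p<s))
         (own-free (subst (InBlock (toℕ i)) (+-identityʳ s) (own-block (hy (σ ⟨$⟩ʳ i))))))
      (blockFree⁺ occupied λ d<len →
         own-free (own-block d<len) , ≤-trans (proj₂ (own-block d<len)) (ends≤total (toℕ<n i)))
      where
      own-block : ∀ {d} → d < len i → InBlock (toℕ i) (s + d)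
      own-block {d} d<len = s≤s (m≤m+n _ d) , subst (s + d ≤_) (sym (ends-suc i))
        (subst (_≤ ends (toℕ i) + len i) (+-suc (ends (toℕ i)) d) (+-monoʳ-≤ (ends (toℕ i)) d<len))

lemma2p4 : (n : ℕ) (y : Fin n → ℕ) → (∀ k → 1 ≤ y k) → (σ : Permutation′ n) → (i : Fin n) →
    length (Pref n y σ i) ≡ 1 + sumL n y σ i
lemma2p4 n y hy σ i = begin
  length (Pref n y σ i)
    ≡⟨ length-filter-interval (λ x → T? _) first≤s s≤m parks-sound parks-complete ⟩
  s ∸ ends first
    ≡⟨ +-∸-assoc 1 (ends-mono first≤) ⟩
  1 + (ends (toℕ i) ∸ ends first)
    ≡⟨ cong (λ e → 1 + (e ∸ ends first)) ends≡ends-first+sumL ⟩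
  1 + (ends first + sumL n y σ i ∸ ends first)
    ≡⟨ cong (1 +_) (m+n∸m≡n (ends first) _) ⟩
  1 + sumL n y σ i ∎
  where
  open ≡-Reasoning
  open Street n y σ
  open Arrival hy i
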